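{- Let $q$ be a prime power, $n$ a positive integer coprime to $q$, $\gamma\in\mathbb{Z}/n\mathbb{Z}$, and let $E$ be an equal-difference subset of $c_{n/q}(\gamma)$ with $|E|=\tau_E$. Then $E$ is a $q^t$-cyclotomic coset modulo $n$, where $t$ is the smallest positive integer such that $\gamma q^t\equiv\gamma\pmod{n/\tau_E}$.
   Context: For $N$ coprime to $n$ (e.g. $N=q^t$), $c_{n/N}(\beta)=\{\beta,\beta N,\dots,\beta N^{\sigma-1}\}\subseteq\mathbb{Z}/n\mathbb{Z}$ with $\sigma$ least positive such that $\beta N^\sigma\equiv\beta\pmod n$; a $q^t$-cyclotomic coset modulo $n$ is a set of the form $c_{n/q^t}(\beta)$. A subset $E\subseteq c_{n/q}(\gamma)$ with $|E|=\tau_E$ is an equal-difference subset if $\tau_E\mid n$ and $E=\{e,e+\frac n{\tau_E},\dots,e+(\tau_E-1)\frac n{\tau_E}\}$ in $\mathbb{Z}/n\mathbb{Z}$ for some $e\in E$. -}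

module Defs where

open import Data.Nat using (ℕ; _+_; _*_; _^_; _≤_; _<_)
open import Data.Nat.Primality using (Prime)
open import Data.Fin using (Fin; toℕ)
open import Data.Fin.Subset using (Subset; _∈_)
open import Data.Product using (Σ; ∃; ∃₂; _×_)
open import Function.Bundles using (_⇔_)
open import Relation.Binary.PropositionalEquality using (_≡_)

IsPrimePower : ℕ → Set
IsPrimePower q = ∃₂ λ p k → Prime p × 1 ≤ k × q ≡ p ^ k

-- a ≡ b (mod m), for any m (m = 0 meaning equality)
Cong : ℕ → ℕ → ℕ → Set
Cong m a b = ∃₂ λ i j → a + i * m ≡ b + j * m

IsLeastPositive : (ℕ → Set) → ℕ → Set
IsLeastPositive P s = 1 ≤ s × P s × (∀ s' → 1 ≤ s' → P s' → s ≤ s')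

-- Elements of ℤ/nℤ are represented by their canonical representatives Fin n.
-- x ∈ c_{n/N}(β) = {β, βN, …, βN^(σ-1)}, σ least positive with βN^σ ≡ β (mod n)
InCoset : (n N : ℕ) → Fin n → Fin n → Set
InCoset n N β x =
  ∃ λ σ → IsLeastPositive (λ s → Cong n (toℕ β * N ^ s) (toℕ β)) σ
        × ∃ λ i → i < σ × Cong n (toℕ x) (toℕ β * N ^ i)

IsCyclotomicCoset : (n N : ℕ) → Subset n → Set
IsCyclotomicCoset n N E = ∃ λ (β : Fin n) → ∀ x → (x ∈ E) ⇔ InCoset n N β x

-- E ⊆ c_{n/q}(γ) is equal-difference with |E| = τ (the hypotheses τ ∣ n,
-- |E| = τ are supplied separately; d plays the role of n/τ, i.e. τ * d ≡ n):
-- E = {e, e + d, …, e + (τ-1) d} in ℤ/nℤ for some e ∈ E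
IsEqualDifference : (n q : ℕ) → Fin n → Subset n → (τ d : ℕ) → Set
IsEqualDifference n q γ E τ d =
  (∀ x → x ∈ E → InCoset n q γ x)
  × ∃ λ (e : Fin n) → e ∈ E
      × (∀ x → (x ∈ E) ⇔ (∃ λ k → k < τ × Cong n (toℕ x) (toℕ e + k * d)))

{-# OPTIONS --safe #-}
-- Since τ * d = n, the equal-difference set E is exactly the residue class of e modulo d.
-- The q-orbit of γ is periodic modulo n and e lies on it, so the periods of e and γ under
-- multiplication by q coincide modulo d; in particular t is the least one for e as well.
-- If x ∈ E then x ≡ e q^j (mod n) for some j, and e q^j ≡ x ≡ e (mod d) forces t ∣ j, so x
-- lies in the q^t-orbit of e; conversely e (q^t)^k ≡ e (mod d) puts that orbit inside E.
-- An orbit is a coset once its least period is found, by search, since Cong n is decidable.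
module Submission where

open import Defs
open import Data.Nat using (ℕ; _*_; _^_; _≤_)
open import Data.Nat.Coprimality using (Coprime)
open import Data.Fin using (Fin; toℕ)
open import Data.Fin.Subset using (Subset; ∣_∣)
open import Relation.Binary.PropositionalEquality using (_≡_)

open import Data.Nat using (zero; suc; _+_; _<_; _≟_; z≤n; s≤s; z<s; NonZero; >-nonZero)
open import Data.Nat.Properties
open import Data.Nat.DivMod using (_%_; _/_; m≡m%n+[m/n]*n; [m+kn]%n≡m%n; m%n<n)
open import Data.Nat.Divisibility using (_∣_; divides; n∣m*n; m%n≡0⇒n∣m)
open import Data.Nat.Tactic.RingSolver using (solve; solve-∀)
open import Data.List using (_∷_; [])
open import Data.Product using (∃; _×_; _,_; map₂)
open import Data.Sum using (_⊎_; inj₁; inj₂)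
open import Data.Fin.Subset using (_∈_)
open import Function.Bundles using (_⇔_; mk⇔; Equivalence)
open import Function.Construct.Composition using (_⇔-∘_)
open import Level using (0ℓ)
open import Relation.Nullary using (¬_; yes; no; contradiction)
import Relation.Nullary.Decidable as Dec
open import Relation.Unary using (Pred)
import Relation.Unary as U
open import Relation.Binary using (Setoid; IsEquivalence; Decidable)
open import Relation.Binary.PropositionalEquality using (refl; sym; trans; cong; subst; subst₂; module ≡-Reasoning)
import Relation.Binary.Reasoning.Setoid as SetoidReasoning
open import Algebra.Properties.CommutativeSemigroup +-commutativeSemigroup using (xy∙z≈xz∙y)

Cong-refl : ∀ {m a} → Cong m a a
Cong-refl = 0 , 0 , refl

Cong-sym : ∀ {m a b} → Cong m a b → Cong m b a
Cong-sym (i , j , eq) = j , i , sym eq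

Cong-trans : ∀ {m a b c} → Cong m a b → Cong m b c → Cong m a c
Cong-trans {m} {a} {b} {c} (i , j , eq₁) (k , l , eq₂) = i + k , l + j , (begin
  a + (i + k) * m       ≡⟨ solve (a ∷ i ∷ k ∷ m ∷ []) ⟩
  (a + i * m) + k * m   ≡⟨ cong (_+ k * m) eq₁ ⟩
  (b + j * m) + k * m   ≡⟨ solve (b ∷ j ∷ k ∷ m ∷ []) ⟩
  (b + k * m) + j * m   ≡⟨ cong (_+ j * m) eq₂ ⟩
  (c + l * m) + j * m   ≡⟨ solve (c ∷ l ∷ j ∷ m ∷ []) ⟩
  c + (l + j) * m       ∎)
  where open ≡-Reasoning

Cong-isEquivalence : ∀ m → IsEquivalence (Cong m)
Cong-isEquivalence m = record { refl = Cong-refl ; sym = Cong-sym ; trans = Cong-trans }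

Cong-setoid : ℕ → Setoid 0ℓ 0ℓ
Cong-setoid m = record { isEquivalence = Cong-isEquivalence m }

module CongReasoning (m : ℕ) = SetoidReasoning (Cong-setoid m)

Cong-*ʳ : ∀ {m a b} c → Cong m a b → Cong m (a * c) (b * c)
Cong-*ʳ {m} {a} {b} c (i , j , eq) = i * c , j * c , (begin
  a * c + i * c * m   ≡⟨ solve (a ∷ c ∷ i ∷ m ∷ []) ⟩
  (a + i * m) * c     ≡⟨ cong (_* c) eq ⟩
  (b + j * m) * c     ≡⟨ solve (b ∷ c ∷ j ∷ m ∷ []) ⟩
  b * c + j * c * m   ∎)
  where open ≡-Reasoning

Cong-weaken : ∀ {d m a b} → d ∣ m → Cong m a b → Cong d a b
Cong-weaken {d} {a = a} {b} (divides k refl) (i , j , eq) = i * k , j * k ,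
  trans (cong (a +_) (*-assoc i k d)) (trans eq (cong (b +_) (sym (*-assoc j k d))))

%≡%⇔Cong : ∀ m .{{_ : NonZero m}} a b → (a % m ≡ b % m) ⇔ Cong m a b
%≡%⇔Cong m a b = mk⇔ from to
  where
  to : Cong m a b → a % m ≡ b % m
  to (i , j , eq) = trans (sym ([m+kn]%n≡m%n a i m)) (trans (cong (_% m) eq) ([m+kn]%n≡m%n b j m))

  from : a % m ≡ b % m → Cong m a b
  from a%m≡b%m = b / m , a / m , (begin
    a + b / m * m                     ≡⟨ cong (_+ b / m * m) (m≡m%n+[m/n]*n a m) ⟩
    a % m + a / m * m + b / m * m     ≡⟨ cong (λ r → r + a / m * m + b / m * m) a%m≡b%m ⟩
    b % m + a / m * m + b / m * m     ≡⟨ xy∙z≈xz∙y (b % m) (a / m * m) (b / m * m) ⟩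
    b % m + b / m * m + a / m * m     ≡⟨ cong (_+ a / m * m) (m≡m%n+[m/n]*n b m) ⟨
    b + a / m * m                     ∎)
    where open ≡-Reasoning

Cong? : ∀ m .{{_ : NonZero m}} → Decidable (Cong m)
Cong? m a b = Dec.map (%≡%⇔Cong m a b) (a % m ≟ b % m)

module _ {P : Pred ℕ 0ℓ} (P? : U.Decidable P) where

  private
    search : ∀ k → ∃ (IsLeastPositive P) ⊎ (∀ s → 1 ≤ s → s ≤ k → ¬ P s)
    search zero = inj₂ λ s 1≤s s≤0 _ → <⇒≱ 1≤s s≤0
    search (suc k) with search k | P? (suc k)
    ... | inj₁ least | _      = inj₁ least
    ... | inj₂ none  | yes Pk = inj₁ (suc k , s≤s z≤n , Pk ,
                                      λ s 1≤s Ps → ≮⇒≥ λ s≤k → none s 1≤s (≤-pred s≤k) Ps)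
    ... | inj₂ none  | no ¬Pk = inj₂ λ s 1≤s s≤1+k → below-or-at 1≤s (m≤n⇒m<n∨m≡n s≤1+k)
      where
      below-or-at : ∀ {s} → 1 ≤ s → s < suc k ⊎ s ≡ suc k → ¬ P s
      below-or-at 1≤s (inj₁ s<1+k) = none _ 1≤s (≤-pred s<1+k)
      below-or-at _   (inj₂ refl)  = ¬Pk

  leastPositive : ∀ {w} → 1 ≤ w → P w → ∃ (IsLeastPositive P)
  leastPositive {w} 1≤w Pw with search w
  ... | inj₁ least = least
  ... | inj₂ none  = contradiction Pw (none w 1≤w ≤-refl)

IsPeriod : (m c a p : ℕ) → Set
IsPeriod m c a p = Cong m (a * c ^ p) a

InOrbit : (m c a y : ℕ) → Set
InOrbit m c a y = ∃ λ k → Cong m y (a * c ^ k)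

*-^-+ : ∀ a c x y → a * c ^ x * c ^ y ≡ a * c ^ (x + y)
*-^-+ a c x y = trans (*-assoc a (c ^ x) (c ^ y)) (cong (a *_) (sym (^-distribˡ-+-* c x y)))

*-^-* : ∀ a c t u → a * c ^ (u * t) ≡ a * (c ^ t) ^ u
*-^-* a c t u = cong (a *_) (trans (cong (c ^_) (*-comm u t)) (sym (^-*-assoc c t u)))

module _ {m c a : ℕ} where
  open CongReasoning m

  Cong-*-^ : ∀ {b x} → Cong m b (a * c ^ x) → ∀ s → Cong m (b * c ^ s) (a * c ^ (x + s))
  Cong-*-^ {b} {x} b≡acˣ s = begin
    b * c ^ s          ≈⟨ Cong-*ʳ (c ^ s) b≡acˣ ⟩
    a * c ^ x * c ^ s  ≡⟨ *-^-+ a c x s ⟩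
    a * c ^ (x + s)    ∎

  period-+ : ∀ {p} → IsPeriod m c a p → ∀ r → Cong m (a * c ^ (p + r)) (a * c ^ r)
  period-+ {p} period r = begin
    a * c ^ (p + r)    ≡⟨ *-^-+ a c p r ⟨
    a * c ^ p * c ^ r  ≈⟨ Cong-*ʳ (c ^ r) period ⟩
    a * c ^ r          ∎

  period-*+ : ∀ {p} → IsPeriod m c a p → ∀ u r → Cong m (a * c ^ (u * p + r)) (a * c ^ r)
  period-*+ period zero    r = Cong-refl
  period-*+ {p} period (suc u) r = begin
    a * c ^ ((p + u * p) + r)  ≡⟨ cong (λ k → a * c ^ k) (+-assoc p (u * p) r) ⟩
    a * c ^ (p + (u * p + r))  ≈⟨ period-+ {p} period (u * p + r) ⟩
    a * c ^ (u * p + r)        ≈⟨ period-*+ period u r ⟩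
    a * c ^ r                  ∎

  period-* : ∀ {p} → IsPeriod m c a p → ∀ u → IsPeriod m c a (u * p)
  period-* {p} period u =
    subst₂ (λ k b → Cong m (a * c ^ k) b) (+-identityʳ (u * p)) (*-identityʳ a) (period-*+ period u 0)

  period-% : ∀ {p} .{{_ : NonZero p}} → IsPeriod m c a p → ∀ k → Cong m (a * c ^ k) (a * c ^ (k % p))
  period-% {p} period k = begin
    a * c ^ k                    ≡⟨ cong (λ j → a * c ^ j) (trans (m≡m%n+[m/n]*n k p) (+-comm (k % p) _)) ⟩
    a * c ^ (k / p * p + k % p)  ≈⟨ period-*+ period (k / p) (k % p) ⟩
    a * c ^ (k % p)              ∎

  period-cancel : ∀ {p x j} → IsPeriod m c a p → x ≤ p →
                  Cong m (a * c ^ (x + j)) (a * c ^ x) → IsPeriod m c a j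
  period-cancel {x = x} {j} period x≤p shifted with m≤n⇒∃[o]m+o≡n x≤p
  ... | z , refl = begin
    a * c ^ j                      ≈⟨ period-+ {x + z} period j ⟨
    a * c ^ ((x + z) + j)          ≡⟨ cong (λ k → a * c ^ k) (xy∙z≈xz∙y x z j) ⟩
    a * c ^ ((x + j) + z)          ≡⟨ *-^-+ a c (x + j) z ⟨
    a * c ^ (x + j) * c ^ z        ≈⟨ Cong-*ʳ (c ^ z) shifted ⟩
    a * c ^ x * c ^ z              ≡⟨ *-^-+ a c x z ⟩
    a * c ^ (x + z)                ≈⟨ period ⟩
    a                              ∎

  orbit-period⇔ : ∀ {p x b} → IsPeriod m c a p → x ≤ p → Cong m b (a * c ^ x) →
                  ∀ s → IsPeriod m c b s ⇔ IsPeriod m c a s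
  orbit-period⇔ {x = x} {b} period x≤p b≡acˣ s = mk⇔ to from
    where
    b*cˢ≡acˣ⁺ˢ : Cong m (b * c ^ s) (a * c ^ (x + s))
    b*cˢ≡acˣ⁺ˢ = Cong-*-^ {x = x} b≡acˣ s

    to : IsPeriod m c b s → IsPeriod m c a s
    to b-period = period-cancel period x≤p (begin
      a * c ^ (x + s)  ≈⟨ b*cˢ≡acˣ⁺ˢ ⟨
      b * c ^ s        ≈⟨ b-period ⟩
      b                ≈⟨ b≡acˣ ⟩
      a * c ^ x        ∎)

    from : IsPeriod m c a s → IsPeriod m c b s
    from a-period = begin
      b * c ^ s        ≈⟨ b*cˢ≡acˣ⁺ˢ ⟩
      a * c ^ (x + s)  ≡⟨ cong (λ k → a * c ^ k) (+-comm x s) ⟩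
      a * c ^ (s + x)  ≈⟨ period-+ {s} a-period x ⟩
      a * c ^ x        ≈⟨ b≡acˣ ⟨
      b                ∎

  period-^ : ∀ {p} → IsPeriod m c a p → ∀ t → IsPeriod m (c ^ t) a p
  period-^ {p} period t =
    subst (λ v → Cong m v a) (trans (cong (λ k → a * c ^ k) (*-comm t p)) (*-^-* a c t p)) (period-* period t)

  orbit-rebase : ∀ {p x b y} → IsPeriod m c a p → x ≤ p → Cong m b (a * c ^ x) →
                 InOrbit m c a y → InOrbit m c b y
  orbit-rebase {x = x} {b} {y} period x≤p b≡acˣ (k , y≡acᵏ) with m≤n⇒∃[o]m+o≡n x≤p
  ... | z , refl = z + k , (begin
    y                        ≈⟨ y≡acᵏ ⟩
    a * c ^ k                ≈⟨ period-+ {x + z} period k ⟨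
    a * c ^ ((x + z) + k)    ≡⟨ cong (λ j → a * c ^ j) (+-assoc x z k) ⟩
    a * c ^ (x + (z + k))    ≈⟨ Cong-*-^ {x = x} b≡acˣ (z + k) ⟨
    b * c ^ (z + k)          ∎)

  least-period-∣ : ∀ {t j} → IsLeastPositive (IsPeriod m c a) t → IsPeriod m c a j → t ∣ j
  least-period-∣ {t} {j} (1≤t , period , least) j-period =
    m%n≡0⇒n∣m j t (below-least-zero (m%n<n j t) remainder-period)
    where
    instance
      t≢0 : NonZero t
      t≢0 = >-nonZero 1≤t

    remainder-period : IsPeriod m c a (j % t)
    remainder-period = Cong-trans (Cong-sym (period-% period j)) j-period

    below-least-zero : ∀ {r} → r < t → IsPeriod m c a r → r ≡ 0
    below-least-zero {zero}  _   _        = refl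
    below-least-zero {suc r} r<t r-period = contradiction (least (suc r) z<s r-period) (<⇒≱ r<t)

  orbit-^⇒Cong : ∀ {t y} → IsPeriod m c a t → InOrbit m (c ^ t) a y → Cong m y a
  orbit-^⇒Cong {t} period (u , y≡a[cᵗ]ᵘ) =
    Cong-trans y≡a[cᵗ]ᵘ (subst (λ v → Cong m v a) (*-^-* a c t u) (period-* period u))

coset⇒orbit : ∀ {m c} {a y : Fin m} → InCoset m c a y → InOrbit m c (toℕ a) (toℕ y)
coset⇒orbit (_ , _ , k , _ , y≡acᵏ) = k , y≡acᵏ

orbit⇒coset : ∀ {m c p} .{{_ : NonZero m}} (a y : Fin m) → IsPeriod m c (toℕ a) p → 1 ≤ p →
              InOrbit m c (toℕ a) (toℕ y) → InCoset m c a y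
orbit⇒coset {m} {c} a y period 1≤p (k , y≡acᵏ) =
  reduce (leastPositive (λ s → Cong? m (toℕ a * c ^ s) (toℕ a)) 1≤p period)
  where
  reduce : ∃ (IsLeastPositive (IsPeriod m c (toℕ a))) → InCoset m c a y
  reduce (σ , σ-least@(1≤σ , σ-period , _)) =
    σ , σ-least , k % σ , m%n<n k σ , Cong-trans y≡acᵏ (period-% {p = σ} σ-period k)
    where
    instance
      σ≢0 : NonZero σ
      σ≢0 = >-nonZero 1≤σ

Cong⇒orbit-^ : ∀ {m d c a b p x t y} → d ∣ m → IsPeriod m c a p → x ≤ p → Cong m b (a * c ^ x) →
               IsLeastPositive (IsPeriod d c a) t → InOrbit m c a y → Cong d y b → InOrbit m (c ^ t) b y
Cong⇒orbit-^ {m} {d} {c} {a} {b} {p} {x} {t} {y} d∣m period x≤p b≡acˣ t-least y∈orbit y≡b =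
  to-power (orbit-rebase {p = p} period x≤p b≡acˣ y∈orbit)
  where
  to-power : InOrbit m c b y → InOrbit m (c ^ t) b y
  to-power (j , y≡bcʲ) = u , subst (Cong m y) (trans (cong (λ k → b * c ^ k) j≡u*t) (*-^-* b c t u)) y≡bcʲ
    where
    a-period-j : IsPeriod d c a j
    a-period-j = Equivalence.to
      (orbit-period⇔ {p = p} {x} {b} (Cong-weaken d∣m period) x≤p (Cong-weaken d∣m b≡acˣ) j)
      (Cong-trans (Cong-sym (Cong-weaken d∣m y≡bcʲ)) y≡b)

    open _∣_ (least-period-∣ {t = t} {j} t-least a-period-j) renaming (quotient to u; equality to j≡u*t)

∈progression⇔Cong : ∀ τ .{{_ : NonZero τ}} d x e →
                    (∃ λ k → k < τ × Cong (τ * d) x (e + k * d)) ⇔ Cong d x e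
∈progression⇔Cong τ@(suc τ′) d x e = mk⇔ to from
  where
  to : (∃ λ k → k < τ × Cong (τ * d) x (e + k * d)) → Cong d x e
  to (k , _ , x≡e+kd) = Cong-trans (Cong-weaken (n∣m*n τ) x≡e+kd) (0 , k , +-identityʳ (e + k * d))

  regroup : ∀ e r Q τ d → e + (r + Q * τ) * d ≡ e + r * d + Q * (τ * d)
  regroup = solve-∀

  from : Cong d x e → ∃ λ k → k < τ × Cong (τ * d) x (e + k * d)
  from (i , j , x+id≡e+jd) = K % τ , m%n<n K τ , i , K / τ , (begin
    x + i * (suc τ′ * d)            ≡⟨ solve (x ∷ i ∷ τ′ ∷ d ∷ []) ⟩
    x + i * d + τ′ * i * d          ≡⟨ cong (_+ τ′ * i * d) x+id≡e+jd ⟩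
    e + j * d + τ′ * i * d          ≡⟨ solve (e ∷ j ∷ τ′ ∷ i ∷ d ∷ []) ⟩
    e + (j + τ′ * i) * d            ≡⟨ cong (λ k → e + k * d) (m≡m%n+[m/n]*n K τ) ⟩
    e + (K % τ + K / τ * τ) * d     ≡⟨ regroup e (K % τ) (K / τ) τ d ⟩
    e + K % τ * d + K / τ * (τ * d) ∎)
    where
    open ≡-Reasoning
    K : ℕ
    K = j + τ′ * i

lemma4p1 : (q n : ℕ) → IsPrimePower q → 1 ≤ n → Coprime n q
    → (γ : Fin n) (E : Subset n) (τ d : ℕ)
    → ∣ E ∣ ≡ τ → τ * d ≡ n
    → IsEqualDifference n q γ E τ d
    → (t : ℕ) → IsLeastPositive (λ s → Cong d (toℕ γ * q ^ s) (toℕ γ)) t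
    → IsCyclotomicCoset n (q ^ t) E
lemma4p1 q _ _ 1≤n _ _ E τ d _ refl (E⊆coset , e , e∈E , E-progression) t t-least@(_ , γ-period-t , _)
  with E⊆coset e e∈E
... | σ , (1≤σ , γ-period-σ , _) , i , i<σ , e≡γqⁱ = e , λ x → mk⇔ (E⇒coset x) (coset⇒E x)
  where
  instance
    n≢0 : NonZero (τ * d)
    n≢0 = >-nonZero 1≤n
    τ≢0 : NonZero τ
    τ≢0 = m*n≢0⇒m≢0 τ

  d∣n : d ∣ τ * d
  d∣n = n∣m*n τ

  E⇔Cong : ∀ x → x ∈ E ⇔ Cong d (toℕ x) (toℕ e)
  E⇔Cong x = ∈progression⇔Cong τ d (toℕ x) (toℕ e) ⇔-∘ E-progression x

  e-period-σ : IsPeriod (τ * d) (q ^ t) (toℕ e) σ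
  e-period-σ = period-^ {c = q} {p = σ}
    (Equivalence.from (orbit-period⇔ γ-period-σ (<⇒≤ i<σ) e≡γqⁱ σ) γ-period-σ) t

  e-period-t : IsPeriod d q (toℕ e) t
  e-period-t = Equivalence.from
    (orbit-period⇔ (Cong-weaken d∣n γ-period-σ) (<⇒≤ i<σ) (Cong-weaken d∣n e≡γqⁱ) t) γ-period-t

  E⇒coset : ∀ x → x ∈ E → InCoset (τ * d) (q ^ t) e x
  E⇒coset x x∈E = orbit⇒coset e x e-period-σ 1≤σ
    (Cong⇒orbit-^ d∣n γ-period-σ (<⇒≤ i<σ) e≡γqⁱ t-least
      (coset⇒orbit (E⊆coset x x∈E)) (Equivalence.to (E⇔Cong x) x∈E))

  coset⇒E : ∀ x → InCoset (τ * d) (q ^ t) e x → x ∈ E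
  coset⇒E x x∈coset =
    Equivalence.from (E⇔Cong x)
      (orbit-^⇒Cong {c = q} {t = t} e-period-t (map₂ (Cong-weaken d∣n) (coset⇒orbit x∈coset)))
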